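{- Let $A$ be a finite set of positive integers with $|A|\ge2$, smallest element $a_1$, largest element $\alpha$ and second largest element $\alpha'$, and let $\beta=\min(\alpha,a_1+\alpha')$. Then $\operatorname{preper}(A)+\operatorname{per}(A)\leq(\beta+1)2^{\alpha-|A|}$.
   Context: $w^A:\mathbb{Z}\to\{0,1\}$ is defined by $w^A(n)=1$ for $n<0$ and $w^A(n)=1-\min\{w^A(n-x):x\in A\}$ for $n\ge0$. $\operatorname{per}(A)$ is the least $p\geq1$ such that $w^A(n)=w^A(n+p)$ for all sufficiently large $n$, and $\operatorname{preper}(A)$ is the least $N\ge0$ such that $w^A(n)=w^A(n+\operatorname{per}(A))$ for all $n\ge N$. -}

module Defs where

open import Data.Bool using (Bool; true; false; not)
open import Data.Nat using (ℕ; zero; suc; _+_; _∸_; _≤_; _<_)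
open import Data.List using (List; []; _∷_; map)
open import Data.Bool.ListAction using (and)
open import Data.Product using (_×_; ∃)
open import Relation.Binary.PropositionalEquality using (_≡_)

-- Values of w^A are encoded as Bool: true = 1, false = 0.
-- `hist A n` is the list [w^A(n-1), w^A(n-2), ..., w^A(0)].

-- w^A(m - x) read from the history of length m; indices past the end are
-- negative arguments, where w^A = 1.
lookupHist : List Bool → ℕ → Bool
lookupHist []       _       = true
lookupHist (b ∷ bs) zero    = b
lookupHist (b ∷ bs) (suc k) = lookupHist bs k

-- w^A(x offset back): for x ≥ 1, w^A(m - x) = lookupHist h (x - 1).
-- (x = 0 never occurs since A consists of positive integers.)
back : List Bool → ℕ → Bool
back h x = lookupHist h (x ∸ 1)

-- w^A(m) = 1 - min { w^A(m - x) : x ∈ A }   (min on {0,1} is `and`)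
step : List ℕ → List Bool → Bool
step A h = not (and (map (back h) A))

hist : List ℕ → ℕ → List Bool
hist A zero    = []
hist A (suc n) = step A (hist A n) ∷ hist A n

-- w^A restricted to n ≥ 0 (for n < 0, w^A(n) = 1 by definition)
w : List ℕ → ℕ → Bool
w A n = step A (hist A n)

EventuallyPeriodic : List ℕ → ℕ → Set
EventuallyPeriodic A p = ∃ λ N → ∀ n → N ≤ n → w A n ≡ w A (n + p)

IsPer : List ℕ → ℕ → Set
IsPer A p = 1 ≤ p × EventuallyPeriodic A p
          × (∀ q → 1 ≤ q → EventuallyPeriodic A q → p ≤ q)

PeriodicFrom : List ℕ → ℕ → ℕ → Set
PeriodicFrom A p N = ∀ n → N ≤ n → w A n ≡ w A (n + p)

IsPreper : List ℕ → ℕ → ℕ → Set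
IsPreper A p N = PeriodicFrom A p N × (∀ M → PeriodicFrom A p M → N ≤ M)

-- w(n) depends only on the window (w(n-1), …, w(n-α)), so the sequence is
-- periodic from the first index m at which a window recurs, say at m' > m,
-- and then preper + per ≤ m'. By pigeonhole m' is at most the number of
-- windows that can occur. In an occurring window a 0 at position i forces a 1
-- at position i + a for every a ∈ A; sorting windows by the position k of
-- their first 0 bounds their number by 1 + Σ_{k<α} 2^u(k), where u(k) ≤
-- min(k, α - |A|) counts the positions in [1, k] outside A. This sum is at
-- most (|A| + 1) 2^(α-|A|), and |A| ≤ β since A ⊆ [1, α], A ∖ {α} ⊆ [1, α']
-- and a₁ ≥ 1.
module Submission where

open import Data.Bool using (Bool; true; false; not)
open import Data.Bool.ListAction using (and)
open import Data.Bool.Properties using (T-≡; not-injective)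
open import Data.Empty using (⊥-elim)
open import Data.Fin as Fin using (toℕ)
open import Data.Fin.Properties using (pigeonhole; injective⇒≤; toℕ≤pred[n])
open import Data.List using (List; []; _∷_; _++_; map; length; lookup; applyUpTo)
open import Data.List.Membership.Propositional using (_∈_)
open import Data.List.Membership.Propositional.Properties using (∈-lookup; ∈-++⁺ˡ; ∈-++⁺ʳ; ∈-map⁺)
open import Data.List.Membership.Setoid.Properties using (index-injective)
open import Data.List.Properties using (length-++; length-map; ∷-injective)
open import Data.List.Relation.Binary.Subset.Propositional using (_⊆_)
open import Data.List.Relation.Unary.All as All using (All; []; _∷_)
open import Data.List.Relation.Unary.All.Properties using (all⁺)
open import Data.List.Relation.Unary.Any using (here; there; index)
open import Data.List.Relation.Unary.AllPairs using (_∷_)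
open import Data.List.Relation.Unary.Unique.Propositional using (Unique)
open import Data.Nat using (ℕ; zero; suc; _+_; _*_; _∸_; _^_; _≤_; _<_; _⊓_; _≟_; z≤n; s≤s)
open import Data.Nat.Properties
open import Data.List.Membership.DecPropositional _≟_ using (_∈?_)
open import Algebra.Properties.CommutativeSemigroup +-commutativeSemigroup using (xy∙z≈xz∙y)
open import Data.Product using (_,_; _×_; proj₁; proj₂; ∃₂)
open import Data.Sum using (inj₁; inj₂)
open import Function using (_∘_)
open import Function.Bundles using (Equivalence)
open import Relation.Binary.PropositionalEquality
open import Relation.Nullary using (yes; no)

open import Defs

lookup-injective : ∀ {X : Set} {xs : List X} → Unique xs →
                   ∀ {i j} → lookup xs i ≡ lookup xs j → i ≡ j
lookup-injective {xs = _ ∷ _} (_ ∷ _)   {Fin.zero}  {Fin.zero}  _ = refl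
lookup-injective {xs = _ ∷ _} (x∉ ∷ _)  {Fin.zero}  {Fin.suc j} e = ⊥-elim (All.lookup x∉ (∈-lookup j) e)
lookup-injective {xs = _ ∷ _} (x∉ ∷ _)  {Fin.suc i} {Fin.zero}  e = ⊥-elim (All.lookup x∉ (∈-lookup i) (sym e))
lookup-injective {xs = _ ∷ _} (_ ∷ xs!) {Fin.suc i} {Fin.suc j} e = cong Fin.suc (lookup-injective xs! e)

Unique-⊆⇒length≤ : ∀ {X : Set} {xs ys : List X} → Unique xs → xs ⊆ ys → length xs ≤ length ys
Unique-⊆⇒length≤ xs! xs⊆ys = injective⇒≤ λ {i} {j} e →
  lookup-injective xs! (index-injective (setoid _) (xs⊆ys (∈-lookup i)) (xs⊆ys (∈-lookup j)) e)

sequence-repeats : ∀ {X : Set} (f : ℕ → X) (ys : List X) → (∀ n → f n ∈ ys) →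
                   ∃₂ λ m m' → m < m' × m' ≤ length ys × f m ≡ f m'
sequence-repeats f ys f∈ys with pigeonhole ≤-refl (λ i → index (f∈ys (toℕ i)))
... | i , j , i<j , e =
  toℕ i , toℕ j , i<j , toℕ≤pred[n] j , index-injective (setoid _) (f∈ys (toℕ i)) (f∈ys (toℕ j)) e

applyUpTo-injective : ∀ {X : Set} (f g : ℕ → X) L → applyUpTo f L ≡ applyUpTo g L →
                      ∀ i → i < L → f i ≡ g i
applyUpTo-injective f g (suc L) e zero    _         = proj₁ (∷-injective e)
applyUpTo-injective f g (suc L) e (suc i) (s≤s i<L) =
  applyUpTo-injective (f ∘ suc) (g ∘ suc) L (proj₂ (∷-injective e)) i i<L

module _ {X : Set} (f : ℕ → X) {q m : ℕ} (q-period : ∀ n → m ≤ n → f n ≡ f (n + q)) where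

  period-multiple : ∀ j n → m ≤ n → f n ≡ f (n + j * q)
  period-multiple zero    n _   = cong f (sym (+-identityʳ n))
  period-multiple (suc j) n m≤n = begin
    f n                 ≡⟨ q-period n m≤n ⟩
    f (n + q)           ≡⟨ period-multiple j (n + q) (≤-trans m≤n (m≤m+n n q)) ⟩
    f (n + q + j * q)   ≡⟨ cong f (+-assoc n q (j * q)) ⟩
    f (n + suc j * q)   ∎
    where open ≡-Reasoning

  -- Comparing n and n + p far out, at n + N₀ q and n + p + N₀ q.
  eventual-period-from : 1 ≤ q → ∀ {p N₀} → (∀ n → N₀ ≤ n → f n ≡ f (n + p)) →
                         ∀ n → m ≤ n → f n ≡ f (n + p)
  eventual-period-from 1≤q {p} {N₀} p-period n m≤n = begin
    f n                 ≡⟨ period-multiple N₀ n m≤n ⟩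
    f (n + N₀ * q)      ≡⟨ p-period (n + N₀ * q) (≤-trans N₀≤N₀q (m≤n+m (N₀ * q) n)) ⟩
    f (n + N₀ * q + p)  ≡⟨ cong f (xy∙z≈xz∙y n (N₀ * q) p) ⟩
    f (n + p + N₀ * q)  ≡⟨ sym (period-multiple N₀ (n + p) (≤-trans m≤n (m≤m+n n p))) ⟩
    f (n + p)           ∎
    where
    open ≡-Reasoning
    N₀≤N₀q : N₀ ≤ N₀ * q
    N₀≤N₀q = ≤-trans (≤-reflexive (sym (*-identityʳ N₀))) (*-monoʳ-≤ N₀ 1≤q)

-- A window of length L is a list of bits; position i holds w(n-1-i).
module Windows (A : List ℕ) where

  Valid : (ℕ → Bool) → Set
  Valid f = ∀ i → f i ≡ false → ∀ a → a ∈ A → f (i + a) ≡ true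

  -- Bit strings of length L with a 1 at every position t such that s + t ∈ A.
  forcedWindows : ℕ → ℕ → List (List Bool)
  forcedWindows s zero    = [] ∷ []
  forcedWindows s (suc L) with s ∈? A
  ... | yes _ = map (true ∷_) (forcedWindows (suc s) L)
  ... | no  _ = map (true ∷_) (forcedWindows (suc s) L) ++ map (false ∷_) (forcedWindows (suc s) L)

  validWindows : ℕ → List (List Bool)
  validWindows zero    = [] ∷ []
  validWindows (suc L) = map (false ∷_) (forcedWindows 1 L) ++ map (true ∷_) (validWindows L)

  membersIn : ℕ → ℕ → List ℕ
  membersIn s zero    = []
  membersIn s (suc L) with s ∈? A
  ... | yes _ = s ∷ membersIn (suc s) L
  ... | no  _ = membersIn (suc s) L

  unforced : ℕ → ℕ → ℕ
  unforced s zero    = zero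
  unforced s (suc L) with s ∈? A
  ... | yes _ = unforced (suc s) L
  ... | no  _ = suc (unforced (suc s) L)

  unforced+members : ∀ s L → unforced s L + length (membersIn s L) ≡ L
  unforced+members s zero    = refl
  unforced+members s (suc L) with s ∈? A
  ... | yes _ = trans (+-suc _ _) (cong suc (unforced+members (suc s) L))
  ... | no  _ = cong suc (unforced+members (suc s) L)

  unforced≤ : ∀ s L → unforced s L ≤ L
  unforced≤ s L = m+n≤o⇒m≤o (unforced s L) (≤-reflexive (unforced+members s L))

  length-membersIn≤ : ∀ s L → length (membersIn s L) ≤ L
  length-membersIn≤ s L = m+n≤o⇒n≤o (unforced s L) (≤-reflexive (unforced+members s L))

  unforced-mono : ∀ s {k L} → k ≤ L → unforced s k ≤ unforced s L
  unforced-mono s {zero}          _         = z≤n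
  unforced-mono s {suc k} {suc L} (s≤s k≤L) with s ∈? A
  ... | yes _ = unforced-mono (suc s) k≤L
  ... | no  _ = s≤s (unforced-mono (suc s) k≤L)

  ∈-membersIn : ∀ s L {a} → a ∈ A → s ≤ a → a < s + L → a ∈ membersIn s L
  ∈-membersIn s zero    {a} _   s≤a a<s+0 = ⊥-elim (<⇒≱ (subst (a <_) (+-identityʳ s) a<s+0) s≤a)
  ∈-membersIn s (suc L) {a} a∈A s≤a a<s+L+1 with s ∈? A | m≤n⇒m<n∨m≡n s≤a
  ... | yes _   | inj₂ refl = here refl
  ... | no  s∉A | inj₂ refl = ⊥-elim (s∉A a∈A)
  ... | yes _   | inj₁ s<a  = there (∈-membersIn (suc s) L a∈A s<a (subst (a <_) (+-suc s L) a<s+L+1))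
  ... | no  _   | inj₁ s<a  = ∈-membersIn (suc s) L a∈A s<a (subst (a <_) (+-suc s L) a<s+L+1)

  length-forcedWindows : ∀ s L → length (forcedWindows s L) ≡ 2 ^ unforced s L
  length-forcedWindows s zero    = refl
  length-forcedWindows s (suc L) with s ∈? A
  ... | yes _ = trans (length-map _ (forcedWindows (suc s) L)) (length-forcedWindows (suc s) L)
  ... | no  _ = begin
    length (map (true ∷_) ws ++ map (false ∷_) ws)         ≡⟨ length-++ (map (true ∷_) ws) ⟩
    length (map (true ∷_) ws) + length (map (false ∷_) ws) ≡⟨ cong₂ _+_ (length-map _ ws) (length-map _ ws) ⟩
    length ws + length ws                                  ≡⟨ cong (λ k → k + k) (length-forcedWindows (suc s) L) ⟩
    2 ^ u + 2 ^ u                                          ≡⟨ cong (2 ^ u +_) (sym (+-identityʳ (2 ^ u))) ⟩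
    2 ^ suc u                                              ∎
    where
    open ≡-Reasoning
    ws = forcedWindows (suc s) L
    u = unforced (suc s) L

  length-validWindows-suc : ∀ L → length (validWindows (suc L)) ≡ 2 ^ unforced 1 L + length (validWindows L)
  length-validWindows-suc L =
    trans (length-++ (map (false ∷_) (forcedWindows 1 L)))
          (cong₂ _+_ (trans (length-map _ (forcedWindows 1 L)) (length-forcedWindows 1 L))
                     (length-map _ (validWindows L)))

  ∈-forcedWindows : ∀ s L g → (∀ t → s + t ∈ A → g t ≡ true) → applyUpTo g L ∈ forcedWindows s L
  ∈-forcedWindows s zero    g forced = here refl
  ∈-forcedWindows s (suc L) g forced =
    extend (∈-forcedWindows (suc s) L (g ∘ suc) λ t s+1+t∈A → forced (suc t) (subst (_∈ A) (sym (+-suc s t)) s+1+t∈A))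
    where
    extend : applyUpTo (g ∘ suc) L ∈ forcedWindows (suc s) L → applyUpTo g (suc L) ∈ forcedWindows s (suc L)
    extend rest with s ∈? A | g 0 in g0
    ... | yes _   | true  = ∈-map⁺ (true ∷_) rest
    ... | no  _   | true  = ∈-++⁺ˡ (∈-map⁺ (true ∷_) rest)
    ... | no  _   | false = ∈-++⁺ʳ (map (true ∷_) (forcedWindows (suc s) L)) (∈-map⁺ (false ∷_) rest)
    ... | yes s∈A | false with () ← trans (sym g0) (forced 0 (subst (_∈ A) (sym (+-identityʳ s)) s∈A))

  ∈-validWindows : ∀ L {f} → Valid f → applyUpTo f L ∈ validWindows L
  ∈-validWindows zero            valid = here refl
  ∈-validWindows (suc L) {f} valid with f 0 in f0
  ... | false = ∈-++⁺ˡ (∈-map⁺ (false ∷_) (∈-forcedWindows 1 L (f ∘ suc) λ t → valid 0 f0 (suc t)))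
  ... | true  = ∈-++⁺ʳ (map (false ∷_) (forcedWindows 1 L))
                       (∈-map⁺ (true ∷_) (∈-validWindows L λ i → valid (suc i)))

  length-validWindows≤2^ : ∀ L → length (validWindows L) ≤ 2 ^ L
  length-validWindows≤2^ zero    = ≤-refl
  length-validWindows≤2^ (suc L) = begin
    length (validWindows (suc L))               ≡⟨ length-validWindows-suc L ⟩
    2 ^ unforced 1 L + length (validWindows L)  ≤⟨ +-mono-≤ (^-monoʳ-≤ 2 (unforced≤ 1 L)) (length-validWindows≤2^ L) ⟩
    2 ^ L + 2 ^ L                               ≡⟨ cong (2 ^ L +_) (sym (+-identityʳ (2 ^ L))) ⟩
    2 ^ suc L                                   ∎
    where open ≤-Reasoning

  length-validWindows≤ : ∀ c d → unforced 1 (d + c) ≤ c → length (validWindows (d + c)) ≤ suc d * 2 ^ c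
  length-validWindows≤ c zero    _    = ≤-trans (length-validWindows≤2^ c) (m≤m+n (2 ^ c) 0)
  length-validWindows≤ c (suc d) u≤c = begin
    length (validWindows (suc (d + c)))                     ≡⟨ length-validWindows-suc (d + c) ⟩
    2 ^ unforced 1 (d + c) + length (validWindows (d + c))  ≤⟨ +-mono-≤ (^-monoʳ-≤ 2 u≤c') (length-validWindows≤ c d u≤c') ⟩
    2 ^ c + suc d * 2 ^ c                                   ∎
    where
    open ≤-Reasoning
    u≤c' : unforced 1 (d + c) ≤ c
    u≤c' = ≤-trans (unforced-mono 1 (n≤1+n (d + c))) u≤c

  module _ (A! : Unique A) (A-pos : All (1 ≤_) A) where

    length≤membersIn : ∀ α → (∀ x → x ∈ A → x ≤ α) → length A ≤ length (membersIn 1 α)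
    length≤membersIn α A≤α = Unique-⊆⇒length≤ A! λ a∈A →
      ∈-membersIn 1 α a∈A (All.lookup A-pos a∈A) (s≤s (A≤α _ a∈A))

    length≤max : ∀ α → (∀ x → x ∈ A → x ≤ α) → length A ≤ α
    length≤max α A≤α = ≤-trans (length≤membersIn α A≤α) (length-membersIn≤ 1 α)

    length≤1+second : ∀ α α' → (∀ x → x ∈ A → x ≢ α → x ≤ α') → length A ≤ suc α'
    length≤1+second α α' A∖α≤α' =
      ≤-trans (Unique-⊆⇒length≤ A! A⊆) (s≤s (length-membersIn≤ 1 α'))
      where
      A⊆ : A ⊆ α ∷ membersIn 1 α'
      A⊆ {x} x∈A with x ≟ α
      ... | yes x≡α = here x≡α
      ... | no  x≢α = there (∈-membersIn 1 α' x∈A (All.lookup A-pos x∈A) (s≤s (A∖α≤α' x x∈A x≢α)))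

    length-validWindows-bound : ∀ α → (∀ x → x ∈ A → x ≤ α) →
                                length (validWindows α) ≤ suc (length A) * 2 ^ (α ∸ length A)
    length-validWindows-bound α A≤α =
      subst (λ L → length (validWindows L) ≤ suc (length A) * 2 ^ (α ∸ length A)) split
        (length-validWindows≤ (α ∸ length A) (length A)
          (subst (λ L → unforced 1 L ≤ α ∸ length A) (sym split) unforced-bound))
      where
      split : length A + (α ∸ length A) ≡ α
      split = m+[n∸m]≡n (length≤max α A≤α)
      unforced-bound : unforced 1 α ≤ α ∸ length A
      unforced-bound = m+n≤o⇒m≤o∸n (unforced 1 α) (begin
        unforced 1 α + length A                   ≤⟨ +-monoʳ-≤ (unforced 1 α) (length≤membersIn α A≤α) ⟩
        unforced 1 α + length (membersIn 1 α)     ≡⟨ unforced+members 1 α ⟩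
        α                                         ∎)
        where open ≤-Reasoning

module Dynamics (A : List ℕ) (A-pos : All (1 ≤_) A) where
  open Windows A

  hist-valid : ∀ n → Valid (lookupHist (hist A n))
  hist-valid zero    i       ()
  hist-valid (suc n) (suc i) = hist-valid n i
  hist-valid (suc n) zero wn≡false a a∈A with All.lookup A-pos a∈A
  ... | s≤s z≤n = Equivalence.to T-≡
        (All.lookup (all⁺ (back (hist A n)) A (Equivalence.from T-≡ (not-injective wn≡false))) a∈A)

  module _ {α : ℕ} (A≤α : ∀ x → x ∈ A → x ≤ α) where

    Agree : List Bool → List Bool → Set
    Agree h h' = ∀ i → i < α → lookupHist h i ≡ lookupHist h' i

    step-cong : ∀ h h' → Agree h h' → step A h ≡ step A h'
    step-cong h h' agree = cong (not ∘ and) (backs-cong A A-pos (All.tabulate (A≤α _)))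
      where
      backs-cong : ∀ xs → All (1 ≤_) xs → All (_≤ α) xs → map (back h) xs ≡ map (back h') xs
      backs-cong []           []      []           = refl
      backs-cong (suc x ∷ xs) (_ ∷ ps) (x<α ∷ bs) = cong₂ _∷_ (agree x x<α) (backs-cong xs ps bs)

    hist-agree : ∀ {m m'} → Agree (hist A m) (hist A m') → ∀ k → Agree (hist A (k + m)) (hist A (k + m'))
    hist-agree             agree zero    = agree
    hist-agree {m} {m'}    agree (suc k) zero    _     = step-cong (hist A (k + m)) (hist A (k + m')) (hist-agree agree k)
    hist-agree             agree (suc k) (suc i) 1+i<α = hist-agree agree k i (≤-trans (n≤1+n (suc i)) 1+i<α)

    window : ℕ → List Bool
    window n = applyUpTo (lookupHist (hist A n)) α

    repeat⇒periodic : ∀ {m m'} → m ≤ m' → window m ≡ window m' → PeriodicFrom A (m' ∸ m) m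
    repeat⇒periodic {m} {m'} m≤m' e n m≤n = begin
      w A n                ≡⟨ cong (w A) (sym (m∸n+n≡m m≤n)) ⟩
      w A (n ∸ m + m)      ≡⟨ step-cong (hist A (n ∸ m + m)) (hist A (n ∸ m + m')) (hist-agree agree (n ∸ m)) ⟩
      w A (n ∸ m + m')     ≡⟨ cong (w A) (sym (+-∸-comm m' m≤n)) ⟩
      w A (n + m' ∸ m)     ≡⟨ cong (w A) (+-∸-assoc n m≤m') ⟩
      w A (n + (m' ∸ m))   ∎
      where
      open ≡-Reasoning
      agree : Agree (hist A m) (hist A m')
      agree = applyUpTo-injective (lookupHist (hist A m)) (lookupHist (hist A m')) α e

    periodic-within : ∃₂ λ m q → 1 ≤ q × m + q ≤ length (validWindows α) × PeriodicFrom A q m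
    periodic-within
      with m , m' , m<m' , m'≤ , e ← sequence-repeats window (validWindows α) (λ n → ∈-validWindows α (hist-valid n))
      = m , m' ∸ m , m<n⇒0<n∸m m<m'
      , subst (_≤ length (validWindows α)) (sym (m+[n∸m]≡n (<⇒≤ m<m'))) m'≤
      , repeat⇒periodic (<⇒≤ m<m') e

theorem2p6 : (A : List ℕ) → Unique A → All (λ x → 1 ≤ x) A → 2 ≤ length A
    → (a₁ α α' : ℕ)
    → a₁ ∈ A → (∀ x → x ∈ A → a₁ ≤ x)
    → α ∈ A → (∀ x → x ∈ A → x ≤ α)
    → α' ∈ A → α' < α → (∀ x → x ∈ A → x ≢ α → x ≤ α')
    → (p N : ℕ) → IsPer A p → IsPreper A p N
    → N + p ≤ ((α ⊓ (a₁ + α')) + 1) * 2 ^ (α ∸ length A)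
theorem2p6 A A! A-pos _ a₁ α α' a₁∈A _ _ A≤α _ _ A∖α≤α' p N (_ , p-period , p-least) (_ , N-least)
  with m , q , 1≤q , m+q≤ , q-period ← Dynamics.periodic-within A A-pos A≤α
  = begin
    N + p                                     ≤⟨ +-mono-≤ N≤m p≤q ⟩
    m + q                                     ≤⟨ m+q≤ ⟩
    length (validWindows α)                   ≤⟨ length-validWindows-bound A! A-pos α A≤α ⟩
    suc (length A) * 2 ^ (α ∸ length A)       ≡⟨ cong (_* 2 ^ (α ∸ length A)) (+-comm 1 (length A)) ⟩
    (length A + 1) * 2 ^ (α ∸ length A)       ≤⟨ *-monoˡ-≤ (2 ^ (α ∸ length A)) (+-monoˡ-≤ 1 |A|≤β) ⟩
    (α ⊓ (a₁ + α') + 1) * 2 ^ (α ∸ length A)  ∎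
  where
  open ≤-Reasoning
  open Windows A
  p≤q : p ≤ q
  p≤q = p-least q 1≤q (m , q-period)
  N≤m : N ≤ m
  N≤m = N-least m (eventual-period-from (w A) q-period 1≤q (proj₂ p-period))
  |A|≤β : length A ≤ α ⊓ (a₁ + α')
  |A|≤β = ⊓-glb (length≤max A! A-pos α A≤α)
                (≤-trans (length≤1+second A! A-pos α α' A∖α≤α') (+-monoˡ-≤ α' (All.lookup A-pos a₁∈A)))
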